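{- Let $P$ be a Sylow $p$-subgroup of $\mathrm{SL}(2,q)$ and let $\tau\in\mathfrak A\ltimes R$ with $P\cdot\tau=P$. Then $\tau=\alpha\rho_x$ with $\alpha\in\mathfrak A_P$ and $x\in P$.
   Context: $p$ is a prime and $q$ a power of $p$. Permutations of $\mathrm{SL}(2,q)$ act on the right (image of a subset $X$ under $\tau$ written $X\cdot\tau$) and are composed left to right. $\mathfrak A$ is the group of permutations of $\mathrm{SL}(2,q)$ given by the group automorphisms of $\mathrm{SL}(2,q)$, $\mathfrak A_P$ its stabilizer of the subset $P$; $R=\{\rho_h: g\mapsto gh\}$; $\mathfrak A\ltimes R$ is the group generated by $\mathfrak A$ and $R$. -}

module Defs where

open import Level using (0ℓ)
open import Data.Nat as ℕ using (ℕ; _^_)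
open import Data.Nat.Divisibility using (_∣_)
open import Data.Nat.Primality using (Prime)
open import Data.Product using (Σ; ∃; _×_; _,_; proj₁; proj₂)
open import Data.List using (List; length; filter; concatMap; map)
open import Data.List.Membership.Propositional using (_∈_)
open import Data.List.Relation.Unary.Unique.Propositional using (Unique)
open import Relation.Binary.PropositionalEquality using (_≡_; _≢_; subst)
open import Axiom.UniquenessOfIdentityProofs using (module Decidable⇒UIP)
open import Relation.Nullary using (Dec; yes; no; ¬_)
open import Relation.Unary using (Pred; Decidable)
open import Algebra.Structures using (IsCommutativeRing)

record FiniteField : Set₁ where
  field
    Carrier : Set
    _+_ _*_ : Carrier → Carrier → Carrier
    -_      : Carrier → Carrier
    0# 1#   : Carrier
  infixl 6 _+_
  infixl 7 _*_
  infix  8 -_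
  field
    isCommutativeRing : IsCommutativeRing _≡_ _+_ _*_ -_ 0# 1#
    0≢1     : 0# ≢ 1#
    inverse : ∀ x → x ≢ 0# → ∃ λ y → x * y ≡ 1#
    _≟_     : (x y : Carrier) → Dec (x ≡ y)
    elements : List Carrier
    complete : ∀ x → x ∈ elements
    unique   : Unique elements

  size : ℕ
  size = length elements

module SL2 (F : FiniteField) where
  open FiniteField F

  record M2 : Set where
    constructor mat
    field a b c d : Carrier
  open M2 public

  _-ᶠ_ : Carrier → Carrier → Carrier
  x -ᶠ y = x + (- y)

  det : M2 → Carrier
  det m = (a m * d m) -ᶠ (b m * c m)

  _·ᴹ_ : M2 → M2 → M2
  m ·ᴹ n = mat (a m * a n + b m * c n) (a m * b n + b m * d n)
               (c m * a n + d m * c n) (c m * b n + d m * d n)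

  SL : Set
  SL = Σ M2 λ m → det m ≡ 1#

  _≈_ : SL → SL → Set
  g ≈ h = proj₁ g ≡ proj₁ h

  I₂ : M2
  I₂ = mat 1# 0# 0# 1#

  IsProd : SL → SL → SL → Set
  IsProd g h k = proj₁ k ≡ proj₁ g ·ᴹ proj₁ h

  allM2 : List M2
  allM2 = concatMap (λ x → concatMap (λ y → concatMap (λ z →
            map (λ w → mat x y z w) elements) elements) elements) elements

  orderSL : ℕ
  orderSL = length (filter (λ m → det m ≟ 1#) allM2)

  card : (P : Pred SL 0ℓ) → Decidable P → ℕ
  card P P? = length (filter dec allM2)
    where
    irr : ∀ {m : M2} (e' e : det m ≡ 1#) → e' ≡ e
    irr = Decidable⇒UIP.≡-irrelevant _≟_
    dec : (m : M2) → Dec (Σ (det m ≡ 1#) λ e → P (m , e))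
    dec m with det m ≟ 1#
    ... | no ¬e = no λ { (e , _) → ¬e e }
    ... | yes e with P? (m , e)
    ...   | yes p = yes (e , p)
    ...   | no ¬p = no λ { (e' , p) → ¬p (subst (λ z → P (m , z)) (irr e' e) p) }

  record IsSubgroup (P : Pred SL 0ℓ) : Set where
    field
      respects : ∀ {g h} → g ≈ h → P g → P h
      hasOne   : ∀ e → proj₁ e ≡ I₂ → P e
      closedMul : ∀ g h k → IsProd g h k → P g → P h → P k
      closedInv : ∀ g h → proj₁ g ·ᴹ proj₁ h ≡ I₂ → P g → P h

  record IsSylow (p : ℕ) (P : Pred SL 0ℓ) : Set where
    field
      subgroup : IsSubgroup P
      decide   : Decidable P
      k        : ℕ
      order    : card P decide ≡ p ^ k
      divides  : (p ^ k) ∣ orderSL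
      maximal  : ¬ ((p ^ ℕ.suc k) ∣ orderSL)

  record IsAut (φ : SL → SL) : Set where
    field
      cong : ∀ {g h} → g ≈ h → φ g ≈ φ h
      hom  : ∀ g h k → IsProd g h k → IsProd (φ g) (φ h) (φ k)
      injective  : ∀ {g h} → φ g ≈ φ h → g ≈ h
      surjective : ∀ h → ∃ λ g → φ g ≈ h

  Stabilizes : (SL → SL) → Pred SL 0ℓ → Set
  Stabilizes τ P = (∀ g → P g → P (τ g)) × (∀ h → P h → ∃ λ g → P g × τ g ≈ h)

  -- the group 𝔄 ⋉ R generated by the automorphisms and the right
  -- multiplications ρ_h : g ↦ g h.  Maps act on the right and compose
  -- left to right: g · (σ τ) = (g · σ) · τ, i.e. (σ τ)(g) = τ (σ g).
  -- Maps are identified up to pointwise ≈.  (SL(2,F) is finite, so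
  -- closure under composition already gives closure under inverses.)
  data InAR : (SL → SL) → Set where
    aut   : ∀ α → IsAut α → InAR α
    right : ∀ h ρ → (∀ g → IsProd g h (ρ g)) → InAR ρ
    comp  : ∀ σ τ → InAR σ → InAR τ → InAR (λ g → τ (σ g))
    ext   : ∀ σ τ → InAR σ → (∀ g → τ g ≈ σ g) → InAR τ

-- Every element of 𝔄 ⋉ R factors as τ = α ρ_x with α ∈ 𝔄, and necessarily
-- x = 1 · τ because automorphisms fix 1.  If τ stabilizes a subgroup P, then
-- x = 1 · τ ∈ P, so ρ_x and ρ_{x⁻¹} stabilize P and hence so does α = τ ρ_{x⁻¹}.
module Submission where

open import Defs
open import Level using (0ℓ)
open import Data.Nat using (ℕ; _^_; _≥_)
open import Data.Nat.Primality using (Prime)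
open import Data.Product using (Σ; ∃; _×_; proj₁; proj₂; _,_)
open import Relation.Binary.PropositionalEquality using (_≡_; refl; sym; trans; cong; cong₂; module ≡-Reasoning)
open import Relation.Unary using (Pred)
open import Algebra.Bundles using (CommutativeRing)
import Algebra.Properties.Ring as RingProperties
import Algebra.Properties.CommutativeSemigroup as CommutativeSemigroupProperties

module SL2Properties (F : FiniteField) where
  open FiniteField F
  open SL2 F
  open ≡-Reasoning

  commutativeRing : CommutativeRing 0ℓ 0ℓ
  commutativeRing = record { isCommutativeRing = isCommutativeRing }

  open CommutativeRing commutativeRing
    using ( zeroˡ; zeroʳ; +-identityˡ; +-identityʳ; *-identityˡ; *-identityʳ
          ; distribˡ; distribʳ; *-assoc; *-comm; +-comm; -‿inverseˡ; ring
          ; +-commutativeSemigroup )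
  open RingProperties ring using (-0#≈0#; -‿distribˡ-*; -‿distribʳ-*; -‿involutive)
  open CommutativeSemigroupProperties +-commutativeSemigroup using (interchange)

  mat-cong : ∀ {a b c d a′ b′ c′ d′} → a ≡ a′ → b ≡ b′ → c ≡ c′ → d ≡ d′ →
             mat a b c d ≡ mat a′ b′ c′ d′
  mat-cong refl refl refl refl = refl

  ·ᴹ-assoc-entry : ∀ a₁ b₁ a₂ b₂ c₂ d₂ a₃ c₃ →
    (a₁ * a₂ + b₁ * c₂) * a₃ + (a₁ * b₂ + b₁ * d₂) * c₃ ≡
    a₁ * (a₂ * a₃ + b₂ * c₃) + b₁ * (c₂ * a₃ + d₂ * c₃)
  ·ᴹ-assoc-entry a₁ b₁ a₂ b₂ c₂ d₂ a₃ c₃ = begin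
    (a₁ * a₂ + b₁ * c₂) * a₃ + (a₁ * b₂ + b₁ * d₂) * c₃
      ≡⟨ cong₂ _+_ (distribʳ a₃ _ _) (distribʳ c₃ _ _) ⟩
    (a₁ * a₂ * a₃ + b₁ * c₂ * a₃) + (a₁ * b₂ * c₃ + b₁ * d₂ * c₃)
      ≡⟨ interchange _ _ _ _ ⟩
    (a₁ * a₂ * a₃ + a₁ * b₂ * c₃) + (b₁ * c₂ * a₃ + b₁ * d₂ * c₃)
      ≡⟨ cong₂ _+_ (cong₂ _+_ (*-assoc _ _ _) (*-assoc _ _ _))
                   (cong₂ _+_ (*-assoc _ _ _) (*-assoc _ _ _)) ⟩
    (a₁ * (a₂ * a₃) + a₁ * (b₂ * c₃)) + (b₁ * (c₂ * a₃) + b₁ * (d₂ * c₃))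
      ≡⟨ cong₂ _+_ (distribˡ a₁ _ _) (distribˡ b₁ _ _) ⟨
    a₁ * (a₂ * a₃ + b₂ * c₃) + b₁ * (c₂ * a₃ + d₂ * c₃) ∎

  ·ᴹ-assoc : ∀ m n o → (m ·ᴹ n) ·ᴹ o ≡ m ·ᴹ (n ·ᴹ o)
  ·ᴹ-assoc (mat a₁ b₁ c₁ d₁) (mat a₂ b₂ c₂ d₂) (mat a₃ b₃ c₃ d₃) =
    mat-cong (·ᴹ-assoc-entry a₁ b₁ a₂ b₂ c₂ d₂ a₃ c₃)
             (·ᴹ-assoc-entry a₁ b₁ a₂ b₂ c₂ d₂ b₃ d₃)
             (·ᴹ-assoc-entry c₁ d₁ a₂ b₂ c₂ d₂ a₃ c₃)
             (·ᴹ-assoc-entry c₁ d₁ a₂ b₂ c₂ d₂ b₃ d₃)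

  1*x+0*y≡x : ∀ x y → 1# * x + 0# * y ≡ x
  1*x+0*y≡x x y = trans (cong₂ _+_ (*-identityˡ x) (zeroˡ y)) (+-identityʳ x)

  0*x+1*y≡y : ∀ x y → 0# * x + 1# * y ≡ y
  0*x+1*y≡y x y = trans (cong₂ _+_ (zeroˡ x) (*-identityˡ y)) (+-identityˡ y)

  x*1+y*0≡x : ∀ x y → x * 1# + y * 0# ≡ x
  x*1+y*0≡x x y = trans (cong₂ _+_ (*-identityʳ x) (zeroʳ y)) (+-identityʳ x)

  x*0+y*1≡y : ∀ x y → x * 0# + y * 1# ≡ y
  x*0+y*1≡y x y = trans (cong₂ _+_ (zeroʳ x) (*-identityʳ y)) (+-identityˡ y)

  ·ᴹ-identityˡ : ∀ m → I₂ ·ᴹ m ≡ m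
  ·ᴹ-identityˡ (mat a b c d) =
    mat-cong (1*x+0*y≡x a c) (1*x+0*y≡x b d) (0*x+1*y≡y a c) (0*x+1*y≡y b d)

  ·ᴹ-identityʳ : ∀ m → m ·ᴹ I₂ ≡ m
  ·ᴹ-identityʳ (mat a b c d) =
    mat-cong (x*1+y*0≡x a b) (x*0+y*1≡y a b) (x*1+y*0≡x c d) (x*0+y*1≡y c d)

  det-I₂ : det I₂ ≡ 1#
  det-I₂ = begin
    1# * 1# + - (0# * 0#) ≡⟨ cong₂ _+_ (*-identityˡ 1#) (cong -_ (zeroˡ 0#)) ⟩
    1# + - 0#             ≡⟨ cong (1# +_) -0#≈0# ⟩
    1# + 0#               ≡⟨ +-identityʳ 1# ⟩
    1#                    ∎

  ε : SL
  ε = I₂ , det-I₂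

  x*-y≡-[y*x] : ∀ x y → x * - y ≡ - (y * x)
  x*-y≡-[y*x] x y = trans (sym (-‿distribʳ-* x y)) (cong -_ (*-comm x y))

  x*-y+y*x≡0 : ∀ x y → x * - y + y * x ≡ 0#
  x*-y+y*x≡0 x y = trans (cong₂ _+_ (sym (-‿distribʳ-* x y)) (*-comm y x)) (-‿inverseˡ (x * y))

  -x*-y≡x*y : ∀ x y → - x * - y ≡ x * y
  -x*-y≡x*y x y = begin
    - x * - y       ≡⟨ -‿distribˡ-* x (- y) ⟨
    - (x * - y)     ≡⟨ cong -_ (-‿distribʳ-* x y) ⟨
    - (- (x * y))   ≡⟨ -‿involutive (x * y) ⟩
    x * y           ∎

  _⁻¹ : SL → SL
  (mat a b c d , det≡1) ⁻¹ = mat d (- b) (- c) a , det-adjugate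
    where
    det-adjugate : d * a + - (- b * - c) ≡ 1#
    det-adjugate = begin
      d * a + - (- b * - c) ≡⟨ cong₂ _+_ (*-comm d a) (cong -_ (-x*-y≡x*y b c)) ⟩
      a * d + - (b * c)     ≡⟨ det≡1 ⟩
      1#                    ∎

  ·ᴹ-inverseʳ : ∀ g → proj₁ g ·ᴹ proj₁ (g ⁻¹) ≡ I₂
  ·ᴹ-inverseʳ (mat a b c d , det≡1) = mat-cong entry₁₁ (x*-y+y*x≡0 a b) entry₂₁ entry₂₂
    where
    entry₁₁ : a * d + b * - c ≡ 1#
    entry₁₁ = trans (cong (a * d +_) (sym (-‿distribʳ-* b c))) det≡1
    entry₂₁ : c * d + d * - c ≡ 0#
    entry₂₁ = trans (+-comm _ _) (x*-y+y*x≡0 d c)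
    entry₂₂ : c * - b + d * a ≡ 1#
    entry₂₂ = begin
      c * - b + d * a   ≡⟨ +-comm _ _ ⟩
      d * a + c * - b   ≡⟨ cong₂ _+_ (*-comm d a) (x*-y≡-[y*x] c b) ⟩
      a * d + - (b * c) ≡⟨ det≡1 ⟩
      1#                ∎

  x≡y·g⇒y≡x·g⁻¹ : ∀ x y g → x ≡ y ·ᴹ proj₁ g → y ≡ x ·ᴹ proj₁ (g ⁻¹)
  x≡y·g⇒y≡x·g⁻¹ x y g x≡y·g = begin
    y                                 ≡⟨ ·ᴹ-identityʳ y ⟨
    y ·ᴹ I₂                           ≡⟨ cong (y ·ᴹ_) (·ᴹ-inverseʳ g) ⟨
    y ·ᴹ (proj₁ g ·ᴹ proj₁ (g ⁻¹))    ≡⟨ ·ᴹ-assoc y _ _ ⟨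
    (y ·ᴹ proj₁ g) ·ᴹ proj₁ (g ⁻¹)    ≡⟨ cong (_·ᴹ proj₁ (g ⁻¹)) x≡y·g ⟨
    x ·ᴹ proj₁ (g ⁻¹)                 ∎

  ·ᴹ-cancelʳ : ∀ x y g → x ·ᴹ proj₁ g ≡ y ·ᴹ proj₁ g → x ≡ y
  ·ᴹ-cancelʳ x y g xg≡yg = begin
    x                              ≡⟨ x≡y·g⇒y≡x·g⁻¹ _ x g refl ⟩
    (x ·ᴹ proj₁ g) ·ᴹ proj₁ (g ⁻¹) ≡⟨ cong (_·ᴹ proj₁ (g ⁻¹)) xg≡yg ⟩
    (y ·ᴹ proj₁ g) ·ᴹ proj₁ (g ⁻¹) ≡⟨ x≡y·g⇒y≡x·g⁻¹ _ y g refl ⟨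
    y                              ∎

  IsAut-ε : ∀ {α} → IsAut α → α ε ≈ ε
  IsAut-ε {α} α-aut = sym (·ᴹ-cancelʳ I₂ (proj₁ (α ε)) (α ε) (begin
    I₂ ·ᴹ proj₁ (α ε)           ≡⟨ ·ᴹ-identityˡ _ ⟩
    proj₁ (α ε)                 ≡⟨ IsAut.hom α-aut ε ε ε (sym (·ᴹ-identityˡ I₂)) ⟩
    proj₁ (α ε) ·ᴹ proj₁ (α ε)  ∎))

  IsAut-id : IsAut (λ g → g)
  IsAut-id = record
    { cong       = λ g≈h → g≈h
    ; hom        = λ _ _ _ k≡gh → k≡gh
    ; injective  = λ g≈h → g≈h
    ; surjective = λ h → h , refl
    }

  IsAut-∘ : ∀ {α β} → IsAut α → IsAut β → IsAut (λ g → β (α g))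
  IsAut-∘ α-aut β-aut = record
    { cong       = λ g≈h → B.cong (A.cong g≈h)
    ; hom        = λ g h k k≡gh → B.hom _ _ _ (A.hom g h k k≡gh)
    ; injective  = λ βαg≈βαh → A.injective (B.injective βαg≈βαh)
    ; surjective = λ h →
        let (g′ , βg′≈h) = B.surjective h
            (g  , αg≈g′) = A.surjective g′
        in  g , trans (B.cong αg≈g′) βg′≈h
    }
    where
    module A = IsAut α-aut
    module B = IsAut β-aut

  -- τ = α ρ_x; the right factor is necessarily x = 1 · τ, since α fixes 1.
  AutRightFactorization : (SL → SL) → Set
  AutRightFactorization τ = Σ (SL → SL) λ α → IsAut α × (∀ g → IsProd (α g) (τ ε) (τ g))

  InAR⇒autRightFactorization : ∀ {τ} → InAR τ → AutRightFactorization τ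
  InAR⇒autRightFactorization (aut τ τ-aut) = τ , τ-aut , λ g → begin
    proj₁ (τ g)                  ≡⟨ ·ᴹ-identityʳ _ ⟨
    proj₁ (τ g) ·ᴹ I₂            ≡⟨ cong (proj₁ (τ g) ·ᴹ_) (IsAut-ε τ-aut) ⟨
    proj₁ (τ g) ·ᴹ proj₁ (τ ε)   ∎
  InAR⇒autRightFactorization (right h ρ ρ≡·h) = (λ g → g) , IsAut-id , λ g → begin
    proj₁ (ρ g)          ≡⟨ ρ≡·h g ⟩
    proj₁ g ·ᴹ proj₁ h   ≡⟨ cong (proj₁ g ·ᴹ_) (trans (ρ≡·h ε) (·ᴹ-identityˡ _)) ⟨
    proj₁ g ·ᴹ proj₁ (ρ ε) ∎
  InAR⇒autRightFactorization (comp σ τ σ∈AR τ∈AR)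
    with InAR⇒autRightFactorization σ∈AR | InAR⇒autRightFactorization τ∈AR
  ... | α , α-aut , σ≡α·σε | β , β-aut , τ≡β·τε =
    (λ g → β (α g)) , IsAut-∘ α-aut β-aut , λ g → begin
      proj₁ (τ (σ g))                                          ≡⟨ τ≡β·τε (σ g) ⟩
      proj₁ (β (σ g)) ·ᴹ proj₁ (τ ε)                           ≡⟨ cong (_·ᴹ proj₁ (τ ε)) (βσ g) ⟩
      (proj₁ (β (α g)) ·ᴹ proj₁ (β (σ ε))) ·ᴹ proj₁ (τ ε)      ≡⟨ ·ᴹ-assoc _ _ _ ⟩
      proj₁ (β (α g)) ·ᴹ (proj₁ (β (σ ε)) ·ᴹ proj₁ (τ ε))      ≡⟨ cong (proj₁ (β (α g)) ·ᴹ_) (τ≡β·τε (σ ε)) ⟨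
      proj₁ (β (α g)) ·ᴹ proj₁ (τ (σ ε))                       ∎
    where
    βσ : ∀ g → proj₁ (β (σ g)) ≡ proj₁ (β (α g)) ·ᴹ proj₁ (β (σ ε))
    βσ g = IsAut.hom β-aut (α g) (σ ε) (σ g) (σ≡α·σε g)
  InAR⇒autRightFactorization (ext σ τ σ∈AR τ≈σ)
    with InAR⇒autRightFactorization σ∈AR
  ... | α , α-aut , σ≡α·σε = α , α-aut , λ g → begin
    proj₁ (τ g)                  ≡⟨ τ≈σ g ⟩
    proj₁ (σ g)                  ≡⟨ σ≡α·σε g ⟩
    proj₁ (α g) ·ᴹ proj₁ (σ ε)   ≡⟨ cong (proj₁ (α g) ·ᴹ_) (τ≈σ ε) ⟨
    proj₁ (α g) ·ᴹ proj₁ (τ ε)   ∎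

  module _ {P : Pred SL 0ℓ} (P-subgroup : IsSubgroup P) where
    open IsSubgroup P-subgroup

    Stabilizes-ε : ∀ {τ} → Stabilizes τ P → P (τ ε)
    Stabilizes-ε (τ-into , _) = τ-into ε (hasOne ε refl)

    Stabilizes-autFactor : ∀ {α τ} → IsAut α → (∀ g → IsProd (α g) (τ ε) (τ g)) →
                           Stabilizes τ P → Stabilizes α P
    Stabilizes-autFactor {α} {τ} α-aut τ≡α·x τ-stab@(τ-into , τ-onto) = α-into , α-onto
      where
      x : SL
      x = τ ε
      Px : P x
      Px = Stabilizes-ε τ-stab
      α-into : ∀ g → P g → P (α g)
      α-into g Pg = closedMul (τ g) (x ⁻¹) (α g) (x≡y·g⇒y≡x·g⁻¹ _ _ x (τ≡α·x g))
                              (τ-into g Pg) (closedInv x (x ⁻¹) (·ᴹ-inverseʳ x) Px)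
      α-onto : ∀ h → P h → ∃ λ g → P g × α g ≈ h
      α-onto h Ph = g′ , Pg′ , trans αg′≈αg αg≈h
        where
        g : SL
        g = proj₁ (IsAut.surjective α-aut h)
        αg≈h : α g ≈ h
        αg≈h = proj₂ (IsAut.surjective α-aut h)
        τg≈h·x : IsProd h x (τ g)
        τg≈h·x = trans (τ≡α·x g) (cong (_·ᴹ proj₁ x) αg≈h)
        preimage : ∃ λ g′ → P g′ × τ g′ ≈ τ g
        preimage = τ-onto (τ g) (closedMul h x (τ g) τg≈h·x Ph Px)
        g′ : SL
        g′ = proj₁ preimage
        Pg′ : P g′
        Pg′ = proj₁ (proj₂ preimage)
        αg′≈αg : α g′ ≈ α g
        αg′≈αg = ·ᴹ-cancelʳ _ _ x
          (trans (sym (τ≡α·x g′)) (trans (proj₂ (proj₂ preimage)) (τ≡α·x g)))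

mainTheorem9 : (p n : ℕ) → Prime p → n ≥ 1 → (F : FiniteField) →
    FiniteField.size F ≡ p ^ n →
    let open SL2 F in
    (P : Pred SL 0ℓ) → IsSylow p P →
    (τ : SL → SL) → InAR τ → Stabilizes τ P →
    Σ (SL → SL) λ α → IsAut α × Stabilizes α P ×
    (∃ λ x → P x × (∀ g → IsProd (α g) x (τ g)))
mainTheorem9 _ _ _ _ F _ P P-sylow τ τ∈AR τ-stab
  with SL2Properties.InAR⇒autRightFactorization F τ∈AR
... | α , α-aut , τ≡α·x =
  α , α-aut , Stabilizes-autFactor P-subgroup α-aut τ≡α·x τ-stab ,
  τ ε , Stabilizes-ε P-subgroup τ-stab , τ≡α·x
  where
  open SL2 F using (IsSubgroup; module IsSylow)
  open SL2Properties F
  P-subgroup : IsSubgroup P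
  P-subgroup = IsSylow.subgroup P-sylow
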